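{- Let $q$ be a prime power and $n,k,t,\lambda$ positive integers with $1 \le t \le k < n$. Then $$\mathcal{A}^r_q(n,k,t;\lambda) \le \left\lfloor \frac{q^n-1}{q^{n-k}-1}\cdot \mathcal{A}^r_q(n-1,k,t;\lambda)\right\rfloor$$ and $$\mathcal{A}_q(n,k,t;\lambda) \le \left\lfloor \frac{q^n-1}{q^{n-k}-1}\cdot \mathcal{A}_q(n-1,k,t;\lambda)\right\rfloor.$$
   Context: A $t$-$(n,k,\lambda)_q$ subspace packing is a collection (possibly a multiset) of $k$-dimensional subspaces (blocks) of $\mathbb{F}_q^n$ such that every $t$-dimensional subspace of $\mathbb{F}_q^n$ is contained in at most $\lambda$ blocks, counted with multiplicity. $\mathcal{A}_q(n,k,t;\lambda)$ denotes the maximum number of blocks in such a packing without repeated blocks, and $\mathcal{A}^r_q(n,k,t;\lambda)$ the maximum number of blocks (counted with multiplicity) when repeated blocks are allowed. -}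

module Defs where

open import Level using (0ℓ)
open import Data.Nat using (ℕ; zero; suc; _≤_; _<_; _^_; _/_)
open import Data.Nat.Primality using (Prime)
open import Data.Fin using (Fin)
open import Data.Fin.Subset using (Subset; _∈_; ∣_∣)
open import Data.Vec using (Vec; []; _∷_; replicate; zipWith; length)
open import Data.List using (List)
import Data.List as L
open import Data.List.Membership.Propositional renaming (_∈_ to _∈ₗ_)
open import Data.List.Relation.Unary.Unique.Propositional using (Unique)
open import Data.Product using (Σ; ∃; _×_)
open import Relation.Nullary using (¬_; Dec)
open import Relation.Binary.PropositionalEquality using (_≡_)
open import Algebra.Structures using (IsCommutativeRing)

IsPrimePower : ℕ → Set
IsPrimePower q = Σ ℕ λ p → Σ ℕ λ e → Prime p × (1 ≤ e) × (q ≡ p ^ e)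

record FiniteField (q : ℕ) : Set₁ where
  field
    Carrier : Set
    _+_ _*_ : Carrier → Carrier → Carrier
    -_      : Carrier → Carrier
    0# 1#   : Carrier
    isCommutativeRing : IsCommutativeRing _≡_ _+_ _*_ -_ 0# 1#
    0≢1     : ¬ (0# ≡ 1#)
    inverse : ∀ x → ¬ (x ≡ 0#) → Σ Carrier λ y → x * y ≡ 1#
    _≟_     : (x y : Carrier) → Dec (x ≡ y)
    elements : List Carrier
    elements-unique   : Unique elements
    elements-complete : ∀ x → x ∈ₗ elements
    elements-size     : L.length elements ≡ q

module LinAlg {q : ℕ} (F : FiniteField q) where
  open FiniteField F

  Vector : ℕ → Set
  Vector n = Vec Carrier n

  zeroV : ∀ {n} → Vector n
  zeroV = replicate _ 0#

  _⊕_ : ∀ {n} → Vector n → Vector n → Vector n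
  _⊕_ = zipWith _+_

  _·_ : ∀ {n} → Carrier → Vector n → Vector n
  c · v = Data.Vec.map (c *_) v

  lincomb : ∀ {n m} → Vec Carrier m → Vec (Vector n) m → Vector n
  lincomb []       []       = zeroV
  lincomb (c ∷ cs) (b ∷ bs) = (c · b) ⊕ lincomb cs bs

  _∈Span_ : ∀ {n m} → Vector n → Vec (Vector n) m → Set
  v ∈Span bs = Σ (Vec Carrier _) λ cs → lincomb cs bs ≡ v

  LinIndep : ∀ {n m} → Vec (Vector n) m → Set
  LinIndep bs = ∀ cs → lincomb cs bs ≡ zeroV → cs ≡ replicate _ 0#

  record Subspace (n k : ℕ) : Set where
    constructor subspace
    field
      basis  : Vec (Vector n) k
      indep  : LinIndep basis
  open Subspace public

  _⊆ₛ_ : ∀ {n t k} → Subspace n t → Subspace n k → Set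
  T ⊆ₛ B = ∀ {v} → v ∈Span basis T → v ∈Span basis B

  _≈ₛ_ : ∀ {n k} → Subspace n k → Subspace n k → Set
  A ≈ₛ B = (A ⊆ₛ B) × (B ⊆ₛ A)

  -- A family of m blocks (k-subspaces of F^n), indexed by Fin m;
  -- repeated blocks are allowed (multiset).
  Family : ℕ → ℕ → ℕ → Set
  Family n k m = Fin m → Subspace n k

  -- every t-subspace is contained in at most λ blocks (with multiplicity)
  IsPacking : ∀ {n k m} → ℕ → ℕ → Family n k m → Set
  IsPacking {n} {k} {m} t λ′ B =
    (T : Subspace n t) (S : Subset m) →
    (∀ {i} → i ∈ S → T ⊆ₛ B i) → ∣ S ∣ ≤ λ′

  NoRepeats : ∀ {n k m} → Family n k m → Set
  NoRepeats {m = m} B = (i j : Fin m) → B i ≈ₛ B j → i ≡ j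

  PackingRep : (n k t λ′ m : ℕ) → Set
  PackingRep n k t λ′ m = Σ (Family n k m) λ B → IsPacking t λ′ B

  Packing : (n k t λ′ m : ℕ) → Set
  Packing n k t λ′ m = Σ (Family n k m) λ B → IsPacking t λ′ B × NoRepeats B

  IsArq : (n k t λ′ a : ℕ) → Set
  IsArq n k t λ′ a = PackingRep n k t λ′ a × (∀ m → PackingRep n k t λ′ m → m ≤ a)

  IsAq : (n k t λ′ a : ℕ) → Set
  IsAq n k t λ′ a = Packing n k t λ′ a × (∀ m → Packing n k t λ′ m → m ≤ a)

-- floor division ⌊ a / b ⌋ (value 0 when b = 0, never used in that case)

⌊_/_⌋ : ℕ → ℕ → ℕ
⌊ a / zero ⌋  = 0
⌊ a / suc b ⌋ = a / suc b

module Submission where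

-- Let C be a t-(n,k,λ)_q packing with a blocks, k < n.  For a nonzero
-- functional f on F^n, deleting a coordinate on which f does not vanish
-- identifies the hyperplane ker f with F^(n-1); the blocks of C inside ker f
-- then form a t-(n-1,k,λ)_q packing (without repeated blocks if C has none),
-- so at most b of them lie in ker f, b being the maximum for F^(n-1).  On the
-- other hand the functionals vanishing on a block form the kernel of a linear
-- map F^n → F^k, so at least q^(n-k) - 1 of them are nonzero.  Double counting
-- the pairs (f , B) with f ≠ 0 and B ⊆ ker f gives a (q^(n-k) - 1) ≤ (q^n - 1) b,
-- and the bound follows by floor division.

open import Defs
open import Data.Nat using (ℕ)

module Counting where

  open import Data.Nat using (ℕ; suc; _+_; _*_; _≤_; z≤n; s≤s)
  open import Data.Nat.Properties
  open import Data.Fin using (Fin)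
  open import Data.List using (List; []; _∷_; _++_; map; length; filter; lookup; cartesianProductWith)
  open import Data.List.Properties using (length-map; length-++; filter-all; filter-none)
  open import Data.List.Membership.Propositional using (_∈_)
  open import Data.List.Membership.Propositional.Properties
    using (∈-∃++; ∈-++⁻; ∈-++⁺ˡ; ∈-++⁺ʳ; ∈-map⁻; ∈-filter⁺; ∈-filter⁻; ∈-lookup)
  open import Data.List.Relation.Unary.Any using (here; there)
  import Data.List.Relation.Unary.All as All
  open import Data.List.Relation.Unary.All.Properties using (all-filter)
  open import Data.List.Relation.Unary.AllPairs using (_∷_)
  open import Data.List.Relation.Unary.Unique.Propositional using (Unique)
  import Data.List.Relation.Unary.Unique.Propositional.Properties as Unique
  open import Data.List.Relation.Binary.Subset.Propositional using (_⊆_)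
  open import Data.Product using (∃; _×_; _,_)
  open import Data.Sum using (_⊎_; inj₁; inj₂)
  open import Data.Empty using (⊥-elim)
  open import Function using (_∘′_)
  open import Relation.Nullary using (Dec; yes; no; ¬?)
  open import Relation.Unary using (Decidable)
  open import Relation.Unary.Properties using (U?)
  open import Relation.Binary.Definitions using (DecidableEquality)
  open import Relation.Binary.PropositionalEquality
  open import Algebra.Properties.CommutativeSemigroup +-commutativeSemigroup
    using (interchange) renaming (x∙yz≈y∙xz to +-exchange)

  private
    variable
      A B : Set

  𝟙 : {P : Set} → Dec P → ℕ
  𝟙 (yes _) = 1
  𝟙 (no _)  = 0

  𝟙≤1 : {P : Set} (d : Dec P) → 𝟙 d ≤ 1
  𝟙≤1 (yes _) = s≤s z≤n
  𝟙≤1 (no _)  = z≤n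

  count : {P : A → Set} → Decidable P → List A → ℕ
  count P? xs = length (filter P? xs)

  count-∷ : {P : A → Set} (P? : Decidable P) (x : A) (xs : List A) →
            count P? (x ∷ xs) ≡ 𝟙 (P? x) + count P? xs
  count-∷ P? x xs with P? x
  ... | yes _ = refl
  ... | no _  = refl

  count-witness : {P : A → Set} (P? : Decidable P) (xs : List A) →
                  count P? xs ≡ 0 ⊎ ∃ λ x → x ∈ xs × P x
  count-witness P? []       = inj₁ refl
  count-witness P? (x ∷ xs) with P? x
  ... | yes px = inj₂ (x , here refl , px)
  ... | no _ with count-witness P? xs
  ...   | inj₁ none          = inj₁ none
  ...   | inj₂ (y , y∈ , py) = inj₂ (y , there y∈ , py)

  length-cartesianProductWith : {C : Set} (f : A → B → C) (xs : List A) (ys : List B) →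
    length (cartesianProductWith f xs ys) ≡ length xs * length ys
  length-cartesianProductWith f []       ys = refl
  length-cartesianProductWith f (x ∷ xs) ys = begin
    length (map (f x) ys ++ cartesianProductWith f xs ys)          ≡⟨ length-++ (map (f x) ys) ⟩
    length (map (f x) ys) + length (cartesianProductWith f xs ys)  ≡⟨ cong₂ _+_ (length-map (f x) ys) (length-cartesianProductWith f xs ys) ⟩
    length ys + length xs * length ys                              ∎
    where open ≡-Reasoning

  ∑ : List A → (A → ℕ) → ℕ
  ∑ []       f = 0
  ∑ (x ∷ xs) f = f x + ∑ xs f

  syntax ∑ xs (λ x → e) = ∑[ x ← xs ] e

  ∑-cong : (xs : List A) {f g : A → ℕ} → (∀ x → f x ≡ g x) → ∑ xs f ≡ ∑ xs g
  ∑-cong []       f≡g = refl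
  ∑-cong (x ∷ xs) f≡g = cong₂ _+_ (f≡g x) (∑-cong xs f≡g)

  ∑-mono : (xs : List A) {f g : A → ℕ} → (∀ {x} → x ∈ xs → f x ≤ g x) → ∑ xs f ≤ ∑ xs g
  ∑-mono []       f≤g = z≤n
  ∑-mono (x ∷ xs) f≤g = +-mono-≤ (f≤g (here refl)) (∑-mono xs (f≤g ∘′ there))

  ∑-const : (xs : List A) (c : ℕ) → ∑[ x ← xs ] c ≡ length xs * c
  ∑-const []       c = refl
  ∑-const (x ∷ xs) c = cong (c +_) (∑-const xs c)

  ∑-+ : (xs : List A) (f g : A → ℕ) → ∑[ x ← xs ] (f x + g x) ≡ ∑ xs f + ∑ xs g
  ∑-+ []       f g = refl
  ∑-+ (x ∷ xs) f g = trans (cong (f x + g x +_) (∑-+ xs f g)) (interchange (f x) (g x) _ _)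

  ∑-swap : (X : List A) (Y : List B) (f : A → B → ℕ) →
           ∑[ x ← X ] ∑[ y ← Y ] f x y ≡ ∑[ y ← Y ] ∑[ x ← X ] f x y
  ∑-swap []      Y f = sym (trans (∑-const Y 0) (*-zeroʳ (length Y)))
  ∑-swap (x ∷ X) Y f = trans (cong (∑ Y (f x) +_) (∑-swap X Y f))
                             (sym (∑-+ Y (f x) (λ y → ∑[ x′ ← X ] f x′ y)))

  count-as-∑ : {P : A → Set} (P? : Decidable P) (xs : List A) → count P? xs ≡ ∑[ x ← xs ] 𝟙 (P? x)
  count-as-∑ P? []       = refl
  count-as-∑ P? (x ∷ xs) = trans (count-∷ P? x xs) (cong (𝟙 (P? x) +_) (count-as-∑ P? xs))

  double-counting : {R : A → B → Set} (R? : ∀ x y → Dec (R x y)) (X : List A) (Y : List B) →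
                    ∑[ x ← X ] count (R? x) Y ≡ ∑[ y ← Y ] count (λ x → R? x y) X
  double-counting R? X Y = begin
    ∑[ x ← X ] count (R? x) Y             ≡⟨ ∑-cong X (λ x → count-as-∑ (R? x) Y) ⟩
    ∑[ x ← X ] ∑[ y ← Y ] 𝟙 (R? x y)      ≡⟨ ∑-swap X Y (λ x y → 𝟙 (R? x y)) ⟩
    ∑[ y ← Y ] ∑[ x ← X ] 𝟙 (R? x y)      ≡⟨ ∑-cong Y (λ y → sym (count-as-∑ (λ x → R? x y) X)) ⟩
    ∑[ y ← Y ] count (λ x → R? x y) X     ∎
    where open ≡-Reasoning

  unique-⊆⇒length≤ : {xs ys : List A} → Unique xs → xs ⊆ ys → length xs ≤ length ys
  unique-⊆⇒length≤ {xs = []}     _            _   = z≤n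
  unique-⊆⇒length≤ {xs = x ∷ xs} (x∉xs ∷ !xs) sub with ∈-∃++ (sub (here refl))
  ... | ys₁ , ys₂ , refl = begin
    suc (length xs)                 ≤⟨ s≤s (unique-⊆⇒length≤ !xs sub′) ⟩
    suc (length (ys₁ ++ ys₂))       ≡⟨ cong suc (length-++ ys₁) ⟩
    suc (length ys₁ + length ys₂)   ≡⟨ +-suc (length ys₁) (length ys₂) ⟨
    length ys₁ + length (x ∷ ys₂)   ≡⟨ length-++ ys₁ ⟨
    length (ys₁ ++ x ∷ ys₂)         ∎
    where
    open ≤-Reasoning
    sub′ : xs ⊆ ys₁ ++ ys₂
    sub′ {y} y∈xs with ∈-++⁻ ys₁ (sub (there y∈xs))
    ... | inj₁ y∈ys₁         = ∈-++⁺ˡ y∈ys₁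
    ... | inj₂ (here refl)   = ⊥-elim (All.lookup x∉xs y∈xs refl)
    ... | inj₂ (there y∈ys₂) = ∈-++⁺ʳ ys₁ y∈ys₂

  count-injection : {P : A → Set} {Q : B → Set} (P? : Decidable P) (Q? : Decidable Q)
                    (h : A → B) → (∀ {x y} → h x ≡ h y → x ≡ y) →
                    {xs : List A} {ys : List B} → Unique xs →
                    (∀ {x} → x ∈ xs → P x → h x ∈ ys × Q (h x)) →
                    count P? xs ≤ count Q? ys
  count-injection P? Q? h h-inj {xs} {ys} !xs maps-into = begin
    count P? xs                      ≡⟨ length-map h (filter P? xs) ⟨
    length (map h (filter P? xs))    ≤⟨ unique-⊆⇒length≤ !image image⊆ ⟩
    count Q? ys                      ∎
    where
    open ≤-Reasoning
    !image : Unique (map h (filter P? xs))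
    !image = Unique.map⁺ h-inj (Unique.filter⁺ P? !xs)
    image⊆ : map h (filter P? xs) ⊆ filter Q? ys
    image⊆ y∈ with ∈-map⁻ h y∈
    ... | x , x∈ , refl with ∈-filter⁻ P? x∈
    ... | x∈xs , px with maps-into x∈xs px
    ... | hx∈ys , qhx = ∈-filter⁺ Q? hx∈ys qhx

  count-remove : (_≟_ : DecidableEquality A) {P : A → Set} (P? : Decidable P)
                 {xs : List A} → Unique xs → {z : A} → z ∈ xs →
                 count P? xs ≡ 𝟙 (P? z) + count P? (filter (λ x → ¬? (z ≟ x)) xs)
  count-remove _≟_ P? {z ∷ xs} (z∉xs ∷ _) (here refl) with z ≟ z
  ... | no z≢z = ⊥-elim (z≢z refl)
  ... | yes _  = trans (count-∷ P? z xs)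
                       (cong (λ ys → 𝟙 (P? z) + count P? ys) (sym (filter-all (λ x → ¬? (z ≟ x)) z∉xs)))
  count-remove {A = A} _≟_ P? {x ∷ xs} (x∉xs ∷ !xs) {z} (there z∈xs) with z ≟ x
  ... | yes refl = ⊥-elim (All.lookup x∉xs z∈xs refl)
  ... | no _     = begin
    count P? (x ∷ xs)                          ≡⟨ count-∷ P? x xs ⟩
    𝟙 (P? x) + count P? xs                     ≡⟨ cong (𝟙 (P? x) +_) (count-remove _≟_ P? !xs z∈xs) ⟩
    𝟙 (P? x) + (𝟙 (P? z) + count P? rest)      ≡⟨ +-exchange (𝟙 (P? x)) (𝟙 (P? z)) (count P? rest) ⟩
    𝟙 (P? z) + (𝟙 (P? x) + count P? rest)      ≡⟨ cong (𝟙 (P? z) +_) (count-∷ P? x rest) ⟨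
    𝟙 (P? z) + count P? (x ∷ rest)             ∎
    where
    open ≡-Reasoning
    rest : List A
    rest = filter (λ x → ¬? (z ≟ x)) xs

  length-remove : (_≟_ : DecidableEquality A) {xs : List A} → Unique xs → {z : A} → z ∈ xs →
                  length xs ≡ suc (length (filter (λ x → ¬? (z ≟ x)) xs))
  length-remove {A = A} _≟_ {xs} !xs {z} z∈xs = begin
    length xs                 ≡⟨ count-everything xs ⟨
    count U? xs               ≡⟨ count-remove _≟_ U? !xs z∈xs ⟩
    suc (count U? rest)       ≡⟨ cong suc (count-everything rest) ⟩
    suc (length rest)         ∎
    where
    open ≡-Reasoning
    rest : List A
    rest = filter (λ x → ¬? (z ≟ x)) xs
    count-everything : ∀ ys → count U? ys ≡ length ys
    count-everything ys = cong length (filter-all U? (All.universal _ ys))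

  count-≡-unique : (_≟_ : DecidableEquality A) {xs : List A} → Unique xs →
                   {z : A} → z ∈ xs → count (z ≟_) xs ≡ 1
  count-≡-unique _≟_ {xs} !xs {z} z∈xs with z ≟ z | count-remove _≟_ (z ≟_) !xs z∈xs
  ... | no z≢z | _  = ⊥-elim (z≢z refl)
  ... | yes _  | eq = trans eq (cong (λ ys → suc (length ys))
                        (filter-none (z ≟_) (all-filter (λ x → ¬? (z ≟ x)) xs)))

  lookup-injective : {xs : List A} → Unique xs → {i j : Fin (length xs)} →
                     lookup xs i ≡ lookup xs j → i ≡ j
  lookup-injective {xs = _ ∷ _} _          {Fin.zero}  {Fin.zero}  _ = refl
  lookup-injective {xs = _ ∷ _} (x∉xs ∷ _) {Fin.zero}  {Fin.suc j} e = ⊥-elim (All.lookup x∉xs (∈-lookup j) e)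
  lookup-injective {xs = _ ∷ _} (x∉xs ∷ _) {Fin.suc i} {Fin.zero}  e = ⊥-elim (All.lookup x∉xs (∈-lookup i) (sym e))
  lookup-injective {xs = _ ∷ _} (_ ∷ !xs)  {Fin.suc i} {Fin.suc j} e = cong Fin.suc (lookup-injective !xs e)

module Subsets where

  open import Data.Nat using (_≤_; z≤n)
  open import Data.Nat.Properties using (module ≤-Reasoning)
  open import Data.Bool using (true)
  open import Data.Fin using (Fin; zero; suc; _≟_)
  open import Data.Fin.Properties using (suc-injective; 0≢1+n; any?)
  open import Data.Fin.Subset using (Subset; inside; outside; _∈_; ∣_∣; _-_)
  open import Data.Fin.Subset.Properties using (_∈?_; x∈p∧x≢y⇒x∈p-y; x∈p⇒∣p-x∣<∣p∣)
  open import Data.Vec using ([]; _∷_; tabulate; here; there)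
  open import Data.Vec.Properties using (lookup∘tabulate; lookup⇒[]=; []=⇒lookup)
  open import Data.Product using (∃; _×_; _,_)
  open import Data.Empty using (⊥-elim)
  open import Relation.Nullary using (yes; no; does)
  open import Relation.Nullary.Decidable using (_×-dec_)
  open import Relation.Binary.PropositionalEquality

  card-injection : ∀ {m′ m} (h : Fin m′ → Fin m) → (∀ {i j} → h i ≡ h j → i ≡ j) →
                   (S′ : Subset m′) (S : Subset m) → (∀ {i} → i ∈ S′ → h i ∈ S) →
                   ∣ S′ ∣ ≤ ∣ S ∣
  card-injection h h-inj []             S _         = z≤n
  card-injection h h-inj (outside ∷ S′) S maps-into =
    card-injection (λ i → h (suc i)) (λ e → suc-injective (h-inj e)) S′ S (λ i∈ → maps-into (there i∈))
  card-injection h h-inj (inside ∷ S′)  S maps-into = begin-strict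
    ∣ S′ ∣           ≤⟨ card-injection (λ i → h (suc i)) (λ e → suc-injective (h-inj e)) S′ (S - h zero) tail-into ⟩
    ∣ S - h zero ∣   <⟨ x∈p⇒∣p-x∣<∣p∣ (maps-into here) ⟩
    ∣ S ∣            ∎
    where
    open ≤-Reasoning
    tail-into : ∀ {i} → i ∈ S′ → h (suc i) ∈ S - h zero
    tail-into i∈ = x∈p∧x≢y⇒x∈p-y (maps-into (there i∈)) (λ e → 0≢1+n (sym (h-inj e)))

  image : ∀ {m′ m} → (Fin m′ → Fin m) → Subset m′ → Subset m
  image h S′ = tabulate (λ j → does (any? (λ i → (i ∈? S′) ×-dec (h i ≟ j))))

  image⁺ : ∀ {m′ m} (h : Fin m′ → Fin m) {S′ : Subset m′} {i : Fin m′} → i ∈ S′ → h i ∈ image h S′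
  image⁺ h {S′} {i} i∈S′ = lookup⇒[]= (h i) (image h S′) (trans (lookup∘tabulate _ (h i)) witnessed)
    where
    witnessed : does (any? (λ i′ → (i′ ∈? S′) ×-dec (h i′ ≟ h i))) ≡ true
    witnessed with any? (λ i′ → (i′ ∈? S′) ×-dec (h i′ ≟ h i))
    ... | yes _   = refl
    ... | no none = ⊥-elim (none (i , i∈S′ , refl))

  image⁻ : ∀ {m′ m} (h : Fin m′ → Fin m) {S′ : Subset m′} {j : Fin m} →
           j ∈ image h S′ → ∃ λ i → i ∈ S′ × h i ≡ j
  image⁻ h {S′} {j} j∈
    with any? (λ i → (i ∈? S′) ×-dec (h i ≟ j)) | trans (sym (lookup∘tabulate _ j)) ([]=⇒lookup j∈)
  ... | yes witness | _ = witness
  ... | no _        | ()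

module LinearAlgebra {q : ℕ} (F : FiniteField q) where

  open import Data.Nat using (suc)
  open import Data.Fin using (Fin; zero; suc)
  open import Data.Vec using (Vec; []; _∷_; map; removeAt; insertAt; lookup)
  open import Data.Vec.Properties
    using (removeAt-insertAt; insertAt-removeAt; insertAt-lookup; ∷-injectiveˡ; ∷-injectiveʳ; ≡-dec;
           map-∘; map-cong; map-id)
  open import Data.Product using (Σ; _,_; proj₁; proj₂)
  open import Data.Empty using (⊥-elim)
  open import Relation.Nullary using (¬_; Dec; yes; no)
  open import Relation.Binary.PropositionalEquality
  open import Algebra.Bundles using (CommutativeRing)

  open FiniteField F using (inverse; _≟_)
  open LinAlg F

  fieldRing : CommutativeRing _ _
  fieldRing = record { isCommutativeRing = FiniteField.isCommutativeRing F }

  open CommutativeRing fieldRing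
    using (Carrier; _+_; _*_; -_; 0#; 1#; +-identityʳ; *-identityˡ; *-assoc; *-comm;
           zeroʳ; distribˡ; -‿inverseˡ; -‿inverseʳ; +-group; +-commutativeSemigroup; *-commutativeSemigroup; ring)
  open import Algebra.Properties.Group +-group using (∙-cancelʳ)
  open import Algebra.Properties.Ring ring using (-1*x≈-x; -‿distribʳ-*)
  open import Algebra.Properties.CommutativeSemigroup +-commutativeSemigroup
    using (interchange) renaming (x∙yz≈y∙xz to +-exchange)
  open import Algebra.Properties.CommutativeSemigroup *-commutativeSemigroup
    using () renaming (x∙yz≈y∙xz to *-exchange)

  private
    variable
      n m : ℕ

  _≟V_ : (u v : Vector n) → Dec (u ≡ v)
  _≟V_ = ≡-dec _≟_

  -- Vector arithmetic: cancellation, and v + (-1)·v = 0, as needed to translate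
  -- fibres of a linear map onto its kernel.

  ⊕-cancelʳ : (u v w : Vector n) → u ⊕ w ≡ v ⊕ w → u ≡ v
  ⊕-cancelʳ []      []      []      _ = refl
  ⊕-cancelʳ (a ∷ u) (b ∷ v) (c ∷ w) e =
    cong₂ _∷_ (∙-cancelʳ c a b (∷-injectiveˡ e)) (⊕-cancelʳ u v w (∷-injectiveʳ e))

  ⊕-inverseʳ : (v : Vector n) → v ⊕ ((- 1#) · v) ≡ zeroV
  ⊕-inverseʳ []      = refl
  ⊕-inverseʳ (a ∷ v) = cong₂ _∷_ (trans (cong (a +_) (-1*x≈-x a)) (-‿inverseʳ a)) (⊕-inverseʳ v)

  -- The standard bilinear form; a vector f is read as the linear functional
  -- v ↦ dot f v.

  dot : Vector n → Vector n → Carrier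
  dot []       []       = 0#
  dot (x ∷ xs) (y ∷ ys) = x * y + dot xs ys

  dot-comm : (u v : Vector n) → dot u v ≡ dot v u
  dot-comm []      []      = refl
  dot-comm (x ∷ u) (y ∷ v) = cong₂ _+_ (*-comm x y) (dot-comm u v)

  dot-zeroʳ : (f : Vector n) → dot f zeroV ≡ 0#
  dot-zeroʳ []      = refl
  dot-zeroʳ (x ∷ f) = trans (cong₂ _+_ (zeroʳ x) (dot-zeroʳ f)) (+-identityʳ 0#)

  dot-⊕ʳ : (f u v : Vector n) → dot f (u ⊕ v) ≡ dot f u + dot f v
  dot-⊕ʳ []      []      []      = sym (+-identityʳ 0#)
  dot-⊕ʳ (x ∷ f) (a ∷ u) (b ∷ v) = begin
    x * (a + b) + dot f (u ⊕ v)               ≡⟨ cong₂ _+_ (distribˡ x a b) (dot-⊕ʳ f u v) ⟩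
    (x * a + x * b) + (dot f u + dot f v)     ≡⟨ interchange (x * a) (x * b) (dot f u) (dot f v) ⟩
    (x * a + dot f u) + (x * b + dot f v)     ∎
    where open ≡-Reasoning

  dot-·ʳ : (f : Vector n) (c : Carrier) (v : Vector n) → dot f (c · v) ≡ c * dot f v
  dot-·ʳ []      c []      = sym (zeroʳ c)
  dot-·ʳ (x ∷ f) c (a ∷ v) = begin
    x * (c * a) + dot f (c · v)     ≡⟨ cong₂ _+_ (*-exchange x c a) (dot-·ʳ f c v) ⟩
    c * (x * a) + c * dot f v       ≡⟨ distribˡ c (x * a) (dot f v) ⟨
    c * (x * a + dot f v)           ∎
    where open ≡-Reasoning

  evaluate : Vec (Vector n) m → Vector n → Vector m
  evaluate bs f = map (dot f) bs

  evaluate-⊕ : (bs : Vec (Vector n) m) (f g : Vector n) → evaluate bs (f ⊕ g) ≡ evaluate bs f ⊕ evaluate bs g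
  evaluate-⊕ []       f g = refl
  evaluate-⊕ (b ∷ bs) f g = cong₂ _∷_ (dot-⊕ˡ f g b) (evaluate-⊕ bs f g)
    where
    dot-⊕ˡ : ∀ f g b → dot (f ⊕ g) b ≡ dot f b + dot g b
    dot-⊕ˡ f g b = trans (dot-comm (f ⊕ g) b) (trans (dot-⊕ʳ b f g) (cong₂ _+_ (dot-comm b f) (dot-comm b g)))

  evaluate-· : (bs : Vec (Vector n) m) (c : Carrier) (f : Vector n) → evaluate bs (c · f) ≡ c · evaluate bs f
  evaluate-· []       c f = refl
  evaluate-· (b ∷ bs) c f = cong₂ _∷_ (dot-·ˡ c f b) (evaluate-· bs c f)
    where
    dot-·ˡ : ∀ c f b → dot (c · f) b ≡ c * dot f b
    dot-·ˡ c f b = trans (dot-comm (c · f) b) (trans (dot-·ʳ b c f) (cong (c *_) (dot-comm b f)))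

  -- f annihilates the vectors bs: it vanishes on each of them, i.e. the span
  -- of bs lies in the hyperplane ker f (when f ≠ 0).
  Annihilates : Vector n → Vec (Vector n) m → Set
  Annihilates f bs = evaluate bs f ≡ zeroV

  annihilates? : (f : Vector n) (bs : Vec (Vector n) m) → Dec (Annihilates f bs)
  annihilates? f bs = evaluate bs f ≟V zeroV

  annihilates-span : (f : Vector n) (cs : Vec Carrier m) (bs : Vec (Vector n) m) →
                     Annihilates f bs → dot f (lincomb cs bs) ≡ 0#
  annihilates-span f []       []       _  = dot-zeroʳ f
  annihilates-span f (c ∷ cs) (b ∷ bs) fb = begin
    dot f ((c · b) ⊕ lincomb cs bs)          ≡⟨ dot-⊕ʳ f (c · b) (lincomb cs bs) ⟩
    dot f (c · b) + dot f (lincomb cs bs)    ≡⟨ cong₂ _+_ (dot-·ʳ f c b) (annihilates-span f cs bs (∷-injectiveʳ fb)) ⟩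
    c * dot f b + 0#                         ≡⟨ cong (λ d → c * d + 0#) (∷-injectiveˡ fb) ⟩
    c * 0# + 0#                              ≡⟨ trans (+-identityʳ _) (zeroʳ c) ⟩
    0#                                       ∎
    where open ≡-Reasoning

  annihilates-∈Span : (f : Vector n) {bs : Vec (Vector n) m} {v : Vector n} →
                      Annihilates f bs → v ∈Span bs → dot f v ≡ 0#
  annihilates-∈Span f {bs} fbs (cs , refl) = annihilates-span f cs bs fbs

  removeAt-⊕ : (u v : Vector (suc n)) (j : Fin (suc n)) → removeAt (u ⊕ v) j ≡ removeAt u j ⊕ removeAt v j
  removeAt-⊕ (x ∷ u)           (y ∷ v)           zero    = refl
  removeAt-⊕ (x ∷ u@(_ ∷ _))   (y ∷ v@(_ ∷ _))   (suc j) = cong ((x + y) ∷_) (removeAt-⊕ u v j)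

  removeAt-· : (c : Carrier) (v : Vector (suc n)) (j : Fin (suc n)) → removeAt (c · v) j ≡ c · removeAt v j
  removeAt-· c (x ∷ v)         zero    = refl
  removeAt-· c (x ∷ v@(_ ∷ _)) (suc j) = cong ((c * x) ∷_) (removeAt-· c v j)

  removeAt-zero : ∀ n (j : Fin (suc n)) → removeAt (zeroV {suc n}) j ≡ zeroV
  removeAt-zero n       zero    = refl
  removeAt-zero (suc n) (suc j) = cong (0# ∷_) (removeAt-zero n j)

  removeAt-lincomb : (cs : Vec Carrier m) (bs : Vec (Vector (suc n)) m) (j : Fin (suc n)) →
                     removeAt (lincomb cs bs) j ≡ lincomb cs (map (λ b → removeAt b j) bs)
  removeAt-lincomb {n = n} [] [] j = removeAt-zero n j
  removeAt-lincomb (c ∷ cs) (b ∷ bs) j =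
    trans (removeAt-⊕ (c · b) (lincomb cs bs) j) (cong₂ _⊕_ (removeAt-· c b j) (removeAt-lincomb cs bs j))

  dot-removeAt : (f v : Vector (suc n)) (j : Fin (suc n)) →
                 dot f v ≡ lookup f j * lookup v j + dot (removeAt f j) (removeAt v j)
  dot-removeAt (x ∷ f)         (y ∷ v)         zero    = refl
  dot-removeAt (x ∷ f@(_ ∷ _)) (y ∷ v@(_ ∷ _)) (suc j) =
    trans (cong (x * y +_) (dot-removeAt f v j)) (+-exchange (x * y) _ _)

  nonzero-coordinate : (f : Vector n) → ¬ (f ≡ zeroV) → Σ (Fin n) λ j → ¬ (lookup f j ≡ 0#)
  nonzero-coordinate []      f≢0 = ⊥-elim (f≢0 refl)
  nonzero-coordinate (x ∷ f) f≢0 with x ≟ 0#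
  ... | no x≢0  = zero , x≢0
  ... | yes refl with nonzero-coordinate f (λ f≡0 → f≢0 (cong (0# ∷_) f≡0))
  ...   | j , fj≢0 = suc j , fj≢0

  -- If the j-th coordinate of f is nonzero,
  -- deleting the j-th coordinate identifies ker f ⊆ F^(n+1) with F^n; the
  -- inverse inserts the unique j-th coordinate that puts a vector into ker f.

  module Hyperplane {n : ℕ} (f : Vector (suc n)) (j : Fin (suc n)) (fj≢0 : ¬ (lookup f j ≡ 0#)) where

    private
      fj fj⁻¹ : Carrier
      fj   = lookup f j
      fj⁻¹ = proj₁ (inverse fj fj≢0)

      f′ : Vector n
      f′ = removeAt f j

      fj*fj⁻¹ : fj * fj⁻¹ ≡ 1#
      fj*fj⁻¹ = proj₂ (inverse fj fj≢0)

      fj⁻¹*fj≡1 : ∀ a → (fj⁻¹ * fj) * a ≡ a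
      fj⁻¹*fj≡1 a = trans (cong (_* a) (trans (*-comm fj⁻¹ fj) fj*fj⁻¹)) (*-identityˡ a)

      fj-cancel : ∀ {a b} → fj * a ≡ fj * b → a ≡ b
      fj-cancel {a} {b} e = begin
        a                  ≡⟨ fj⁻¹*fj≡1 a ⟨
        (fj⁻¹ * fj) * a    ≡⟨ *-assoc fj⁻¹ fj a ⟩
        fj⁻¹ * (fj * a)    ≡⟨ cong (fj⁻¹ *_) e ⟩
        fj⁻¹ * (fj * b)    ≡⟨ *-assoc fj⁻¹ fj b ⟨
        (fj⁻¹ * fj) * b    ≡⟨ fj⁻¹*fj≡1 b ⟩
        b                  ∎
        where open ≡-Reasoning

    project : Vector (suc n) → Vector n
    project v = removeAt v j

    lift : Vector n → Vector (suc n)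
    lift w = insertAt w j (- (fj⁻¹ * dot f′ w))

    project-lift : ∀ w → project (lift w) ≡ w
    project-lift w = removeAt-insertAt w j _

    lift-∈ker : ∀ w → dot f (lift w) ≡ 0#
    lift-∈ker w = begin
      dot f (lift w)                                       ≡⟨ dot-removeAt f (lift w) j ⟩
      fj * lookup (lift w) j + dot f′ (project (lift w))   ≡⟨ cong₂ (λ a b → fj * a + dot f′ b) (insertAt-lookup w j _) (project-lift w) ⟩
      fj * - (fj⁻¹ * d) + d                                ≡⟨ cong (_+ d) (-‿distribʳ-* fj (fj⁻¹ * d)) ⟨
      - (fj * (fj⁻¹ * d)) + d                              ≡⟨ cong (λ a → - a + d) (*-assoc fj fj⁻¹ d) ⟨
      - ((fj * fj⁻¹) * d) + d                              ≡⟨ cong (λ a → - (a * d) + d) fj*fj⁻¹ ⟩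
      - (1# * d) + d                                       ≡⟨ cong (λ a → - a + d) (*-identityˡ d) ⟩
      - d + d                                              ≡⟨ -‿inverseˡ d ⟩
      0#                                                   ∎
      where
      open ≡-Reasoning
      d : Carrier
      d = dot f′ w

    project-injective : ∀ {u v} → dot f u ≡ 0# → dot f v ≡ 0# → project u ≡ project v → u ≡ v
    project-injective {u} {v} fu≡0 fv≡0 pu≡pv = begin
      u                                   ≡⟨ insertAt-removeAt u j ⟨
      insertAt (project u) j (lookup u j) ≡⟨ cong₂ (λ w x → insertAt w j x) pu≡pv (fj-cancel (∙-cancelʳ _ _ _ same-sum)) ⟩
      insertAt (project v) j (lookup v j) ≡⟨ insertAt-removeAt v j ⟩
      v                                   ∎
      where
      open ≡-Reasoning
      same-sum : fj * lookup u j + dot f′ (project v) ≡ fj * lookup v j + dot f′ (project v)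
      same-sum = begin
        fj * lookup u j + dot f′ (project v)   ≡⟨ cong (λ w → fj * lookup u j + dot f′ w) pu≡pv ⟨
        fj * lookup u j + dot f′ (project u)   ≡⟨ dot-removeAt f u j ⟨
        dot f u                                ≡⟨ trans fu≡0 (sym fv≡0) ⟩
        dot f v                                ≡⟨ dot-removeAt f v j ⟩
        fj * lookup v j + dot f′ (project v)   ∎

    project-lincomb : ∀ {m} (cs : Vec Carrier m) (bs : Vec (Vector (suc n)) m) →
                      project (lincomb cs bs) ≡ lincomb cs (map project bs)
    project-lincomb cs bs = removeAt-lincomb cs bs j

    project-lift-lincomb : ∀ {m} (cs : Vec Carrier m) (ws : Vec (Vector n) m) →
                           project (lincomb cs (map lift ws)) ≡ lincomb cs ws
    project-lift-lincomb cs ws = trans (project-lincomb cs (map lift ws))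
      (cong (lincomb cs) (trans (sym (map-∘ project lift ws)) (trans (map-cong project-lift ws) (map-id ws))))

    lift-annihilated : ∀ {m} (ws : Vec (Vector n) m) → Annihilates f (map lift ws)
    lift-annihilated []       = refl
    lift-annihilated (w ∷ ws) = cong₂ _∷_ (lift-∈ker w) (lift-annihilated ws)

    restrict : ∀ {k} (C : Subspace (suc n) k) → Annihilates f (basis C) → Subspace n k
    restrict C fC = subspace (map project (basis C)) independent
      where
      independent : LinIndep (map project (basis C))
      independent cs e = indep C cs (project-injective (annihilates-span f cs (basis C) fC) (dot-zeroʳ f)
        (trans (project-lincomb cs (basis C)) (trans e (sym (removeAt-zero n j)))))

    extend : ∀ {t} → Subspace n t → Subspace (suc n) t
    extend T = subspace (map lift (basis T)) independent
      where
      independent : LinIndep (map lift (basis T))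
      independent cs e = indep T cs
        (trans (sym (project-lift-lincomb cs (basis T))) (trans (cong project e) (removeAt-zero n j)))

    extend-⊆ : ∀ {t k} (T : Subspace n t) (C : Subspace (suc n) k) (fC : Annihilates f (basis C)) →
               T ⊆ₛ restrict C fC → extend T ⊆ₛ C
    extend-⊆ T C fC T⊆C′ {v} v∈T′@(cs , e) with T⊆C′ (cs , trans (sym (project-lift-lincomb cs (basis T))) (cong project e))
    ... | ds , e′ = ds , project-injective (annihilates-span f ds (basis C) fC)
                           (annihilates-∈Span f (lift-annihilated (basis T)) v∈T′)
                           (trans (project-lincomb ds (basis C)) e′)

    restrict-reflects-⊆ : ∀ {k} (C C′ : Subspace (suc n) k)
                          (fC : Annihilates f (basis C)) (fC′ : Annihilates f (basis C′)) →
                          restrict C fC ⊆ₛ restrict C′ fC′ → C ⊆ₛ C′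
    restrict-reflects-⊆ C C′ fC fC′ C⊆C′ {v} v∈C@(cs , e) with C⊆C′ (cs , trans (sym (project-lincomb cs (basis C))) (cong project e))
    ... | ds , e′ = ds , project-injective (annihilates-span f ds (basis C′) fC′)
                           (annihilates-∈Span f fC v∈C)
                           (trans (project-lincomb ds (basis C′)) e′)

module Enumeration {q : ℕ} (F : FiniteField q) where

  open import Data.Nat using (zero; suc; _*_; _^_; _≤_; z≤n)
  open import Data.Nat.Properties using (*-identityʳ; module ≤-Reasoning)
  open import Data.Vec using (Vec; []; _∷_)
  open import Data.Vec.Properties using (∷-injective)
  open import Data.List using (List; [_]; length; cartesianProductWith)
  import Data.List as List
  open import Data.List.Membership.Propositional using (_∈_)
  import Data.List.Relation.Unary.Any.Properties as Any
  open import Data.List.Relation.Unary.Any using (here)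
  open import Data.List.Relation.Unary.Unique.Propositional using (Unique)
  import Data.List.Relation.Unary.Unique.Propositional.Properties as Unique
  import Data.List.Relation.Unary.AllPairs as AllPairs
  import Data.List.Relation.Unary.All as All
  open import Data.Product using (_,_)
  open import Data.Sum using (inj₁; inj₂)
  open import Relation.Binary.PropositionalEquality hiding ([_])

  open Counting
  open LinearAlgebra F
  open FiniteField F using (elements; elements-unique; elements-complete; elements-size; -_; 0#; 1#; 0≢1)
  open LinAlg F

  vectors : ∀ n → List (Vector n)
  vectors zero    = [ [] ]
  vectors (suc n) = cartesianProductWith _∷_ elements (vectors n)

  vectors-unique : ∀ n → Unique (vectors n)
  vectors-unique zero    = All.[] AllPairs.∷ AllPairs.[]
  vectors-unique (suc n) = Unique.cartesianProductWith⁺ _∷_ ∷-injective elements-unique (vectors-unique n)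

  vectors-complete : ∀ {n} (v : Vector n) → v ∈ vectors n
  vectors-complete []      = here refl
  vectors-complete (x ∷ v) =
    Any.cartesianProductWith⁺ _∷_ (λ { refl refl → refl }) (elements-complete x) (vectors-complete v)

  length-vectors : ∀ n → length (vectors n) ≡ q ^ n
  length-vectors zero    = refl
  length-vectors (suc n) = trans (length-cartesianProductWith _∷_ elements (vectors n))
                                 (cong₂ _*_ elements-size (length-vectors n))

  -- A linear map g : F^n → F^k has a kernel of at least q^n / q^k elements:
  -- its fibres partition F^n, and every nonempty fibre is a translate of the
  -- kernel, hence no larger than the kernel.
  module LinearMap {n k : ℕ} (g : Vector n → Vector k)
                   (g-⊕ : ∀ u v → g (u ⊕ v) ≡ g u ⊕ g v)
                   (g-· : ∀ c v → g (c · v) ≡ c · g v) where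

    fibre : Vector k → ℕ
    fibre y = count (λ v → g v ≟V y) (vectors n)

    fibre≤kernel : ∀ y → fibre y ≤ fibre zeroV
    fibre≤kernel y with count-witness (λ v → g v ≟V y) (vectors n)
    ... | inj₁ empty = subst (_≤ fibre zeroV) (sym empty) z≤n
    ... | inj₂ (v₀ , _ , gv₀≡y) =
      count-injection (λ v → g v ≟V y) (λ v → g v ≟V zeroV) (_⊕ w) (λ {u} {v} → ⊕-cancelʳ u v w)
        (vectors-unique n) (λ {v} _ gv≡y → vectors-complete (v ⊕ w) , translate-to-kernel v gv≡y)
      where
      w : Vector n
      w = (- 1#) · v₀
      translate-to-kernel : ∀ v → g v ≡ y → g (v ⊕ w) ≡ zeroV
      translate-to-kernel v gv≡y = begin
        g (v ⊕ w)                 ≡⟨ g-⊕ v w ⟩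
        g v ⊕ g w                 ≡⟨ cong₂ _⊕_ gv≡y (trans (g-· (- 1#) v₀) (cong ((- 1#) ·_) gv₀≡y)) ⟩
        y ⊕ ((- 1#) · y)          ≡⟨ ⊕-inverseʳ y ⟩
        zeroV                     ∎
        where open ≡-Reasoning

    fibres-partition : ∑[ y ← vectors k ] fibre y ≡ q ^ n
    fibres-partition = begin
      ∑[ y ← vectors k ] count (λ v → g v ≟V y) (vectors n)   ≡⟨ double-counting (λ v y → g v ≟V y) (vectors n) (vectors k) ⟨
      ∑[ v ← vectors n ] count (g v ≟V_) (vectors k)          ≡⟨ ∑-cong (vectors n) (λ v → count-≡-unique _≟V_ (vectors-unique k) (vectors-complete (g v))) ⟩
      ∑[ v ← vectors n ] 1                                     ≡⟨ ∑-const (vectors n) 1 ⟩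
      length (vectors n) * 1                                   ≡⟨ trans (*-identityʳ _) (length-vectors n) ⟩
      q ^ n                                                    ∎
      where open ≡-Reasoning

    kernel-size : q ^ n ≤ q ^ k * fibre zeroV
    kernel-size = begin
      q ^ n                                    ≡⟨ fibres-partition ⟨
      ∑[ y ← vectors k ] fibre y               ≤⟨ ∑-mono (vectors k) (λ {y} _ → fibre≤kernel y) ⟩
      ∑[ y ← vectors k ] fibre zeroV           ≡⟨ ∑-const (vectors k) (fibre zeroV) ⟩
      length (vectors k) * fibre zeroV         ≡⟨ cong (_* fibre zeroV) (length-vectors k) ⟩
      q ^ k * fibre zeroV                      ∎
      where open ≤-Reasoning

  annihilators-count : ∀ {n k} (bs : Vec (Vector n) k) →
                       q ^ n ≤ q ^ k * count (λ f → annihilates? f bs) (vectors n)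
  annihilators-count bs = LinearMap.kernel-size (evaluate bs) (evaluate-⊕ bs) (evaluate-· bs)

  two≤q : 2 ≤ q
  two≤q = subst (2 ≤_) elements-size
    (unique-⊆⇒length≤ {xs = 0# List.∷ [ 1# ]} 0,1-distinct (λ _ → elements-complete _))
    where
    0,1-distinct : Unique (0# List.∷ [ 1# ])
    0,1-distinct = (0≢1 All.∷ All.[]) AllPairs.∷ All.[] AllPairs.∷ AllPairs.[]

module Restriction {q : ℕ} (F : FiniteField q) where

  open import Data.Nat using (suc; _≤_)
  open import Data.Nat.Properties using (module ≤-Reasoning)
  open import Data.Fin using (Fin)
  open import Data.Fin.Subset using (∣_∣) renaming (_∈_ to _∈ₛ_)
  open import Data.List using (List; length; filter; lookup; allFin)
  open import Data.List.Membership.Propositional.Properties using (∈-filter⁻; ∈-lookup)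
  import Data.List.Relation.Unary.Unique.Propositional.Properties as Unique
  open import Data.Product using (_,_; proj₁; proj₂)
  open import Relation.Nullary using (¬_)
  open import Relation.Unary using (Decidable)
  open import Relation.Binary.PropositionalEquality

  open Counting
  open Subsets
  open LinearAlgebra F
  open LinAlg F

  module BlocksInHyperplane {n k a : ℕ} (C : Family (suc n) k a)
                            (f : Vector (suc n)) (f≢0 : ¬ (f ≡ zeroV)) where

    inHyperplane? : Decidable (λ i → Annihilates f (basis (C i)))
    inHyperplane? i = annihilates? f (basis (C i))

    blocksInHyperplane : List (Fin a)
    blocksInHyperplane = filter inHyperplane? (allFin a)

    index : Fin (length blocksInHyperplane) → Fin a
    index = lookup blocksInHyperplane

    index-injective : ∀ {i j} → index i ≡ index j → i ≡ j
    index-injective = lookup-injective (Unique.filter⁺ inHyperplane? (Unique.allFin⁺ a))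

    index-inHyperplane : ∀ i → Annihilates f (basis (C (index i)))
    index-inHyperplane i = proj₂ (∈-filter⁻ inHyperplane? {xs = allFin a} (∈-lookup i))

    open Hyperplane f (proj₁ (nonzero-coordinate f f≢0)) (proj₂ (nonzero-coordinate f f≢0))

    restriction : Family n k (length blocksInHyperplane)
    restriction i = restrict (C (index i)) (index-inHyperplane i)

    -- A t-subspace T of F^n in the blocks S′ of the restriction lies, viewed
    -- in ker f, in the corresponding blocks of C.
    restriction-packing : ∀ {t λ′} → IsPacking t λ′ C → IsPacking t λ′ restriction
    restriction-packing {λ′ = λ′} packing T S′ T⊆S′ = begin
      ∣ S′ ∣               ≤⟨ card-injection index index-injective S′ (image index S′) (image⁺ index) ⟩
      ∣ image index S′ ∣   ≤⟨ packing (extend T) (image index S′) extend-T⊆ ⟩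
      λ′                   ∎
      where
      open ≤-Reasoning
      extend-T⊆ : ∀ {i} → i ∈ₛ image index S′ → extend T ⊆ₛ C i
      extend-T⊆ i∈ with image⁻ index i∈
      ... | i′ , i′∈S′ , refl = extend-⊆ T (C (index i′)) (index-inHyperplane i′) (T⊆S′ i′∈S′)

    restriction-noRepeats : NoRepeats C → NoRepeats restriction
    restriction-noRepeats noRepeats i j (i⊆j , j⊆i) = index-injective (noRepeats (index i) (index j)
      ( restrict-reflects-⊆ (C (index i)) (C (index j)) (index-inHyperplane i) (index-inHyperplane j) i⊆j
      , restrict-reflects-⊆ (C (index j)) (C (index i)) (index-inHyperplane j) (index-inHyperplane i) j⊆i))

  blocks-in-hyperplane≤ᵣ : ∀ {n k t λ′ a b} (C : Family (suc n) k a) → IsPacking t λ′ C →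
    (∀ m → PackingRep n k t λ′ m → m ≤ b) →
    ∀ f → ¬ (f ≡ zeroV) → count (λ i → annihilates? f (basis (C i))) (allFin a) ≤ b
  blocks-in-hyperplane≤ᵣ C packing maximal f f≢0 =
    maximal _ (restriction , restriction-packing packing)
    where open BlocksInHyperplane C f f≢0

  blocks-in-hyperplane≤ : ∀ {n k t λ′ a b} (C : Family (suc n) k a) → IsPacking t λ′ C → NoRepeats C →
    (∀ m → Packing n k t λ′ m → m ≤ b) →
    ∀ f → ¬ (f ≡ zeroV) → count (λ i → annihilates? f (basis (C i))) (allFin a) ≤ b
  blocks-in-hyperplane≤ C packing noRepeats maximal f f≢0 =
    maximal _ (restriction , restriction-packing packing , restriction-noRepeats noRepeats)
    where open BlocksInHyperplane C f f≢0

module DoubleCounting {q : ℕ} (F : FiniteField q) where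

  open import Data.Nat using (suc; _+_; _*_; _^_; _∸_; _≤_; NonZero; >-nonZero; z≤n; s≤s)
  open import Data.Nat.Properties
    using (≤-refl; ≤-trans; +-mono-≤; *-cancelˡ-≤; m^n≢0; m+[n∸m]≡n; ^-distribˡ-+-*; ∸-monoˡ-≤; module ≤-Reasoning)
  open import Data.Fin using (Fin)
  open import Data.Vec using (Vec)
  open import Data.List using (List; length; filter; allFin)
  open import Data.List.Properties using (length-tabulate)
  open import Data.List.Membership.Propositional using (_∈_)
  open import Data.List.Membership.Propositional.Properties using (∈-filter⁻)
  open import Data.Product using (proj₂)
  open import Relation.Nullary using (¬_; ¬?; Dec)
  open import Relation.Binary.PropositionalEquality

  open Counting
  open LinearAlgebra F
  open Enumeration F
  open LinAlg F

  instance
    q-nonZero : NonZero q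
    q-nonZero = >-nonZero (≤-trans (s≤s z≤n) two≤q)

  nonzeroVectors : ∀ n → List (Vector n)
  nonzeroVectors n = filter (λ f → ¬? (zeroV ≟V f)) (vectors n)

  length-nonzeroVectors : ∀ n → length (nonzeroVectors n) ≡ q ^ n ∸ 1
  length-nonzeroVectors n = begin
    suc (length (nonzeroVectors n)) ∸ 1   ≡⟨ cong (_∸ 1) (length-remove _≟V_ (vectors-unique n) (vectors-complete zeroV)) ⟨
    length (vectors n) ∸ 1                ≡⟨ cong (_∸ 1) (length-vectors n) ⟩
    q ^ n ∸ 1                             ∎
    where open ≡-Reasoning

  nonzero-annihilators : ∀ {n k} → k ≤ n → (bs : Vec (Vector n) k) →
                         q ^ (n ∸ k) ∸ 1 ≤ count (λ f → annihilates? f bs) (nonzeroVectors n)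
  nonzero-annihilators {n} {k} k≤n bs = ∸-monoˡ-≤ 1 (begin
    q ^ (n ∸ k)                             ≤⟨ *-cancelˡ-≤ (q ^ k) {{m^n≢0 q k}} q^k*q^[n∸k]≤ ⟩
    count P? (vectors n)                    ≡⟨ count-remove _≟V_ P? (vectors-unique n) (vectors-complete zeroV) ⟩
    𝟙 (P? zeroV) + count P? (nonzeroVectors n)  ≤⟨ +-mono-≤ (𝟙≤1 (P? zeroV)) ≤-refl ⟩
    suc (count P? (nonzeroVectors n))       ∎)
    where
    open ≤-Reasoning
    P? : (f : Vector n) → Dec (Annihilates f bs)
    P? f = annihilates? f bs
    -- the annihilators form the kernel of evaluation F^n → F^k
    q^k*q^[n∸k]≤ : q ^ k * q ^ (n ∸ k) ≤ q ^ k * count P? (vectors n)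
    q^k*q^[n∸k]≤ = subst (_≤ q ^ k * count P? (vectors n))
      (trans (cong (q ^_) (sym (m+[n∸m]≡n k≤n))) (^-distribˡ-+-* q k (n ∸ k)))
      (annihilators-count bs)

  hyperplane-double-count : ∀ {n k a b} → k ≤ n → (C : Family n k a) →
    (∀ f → ¬ (f ≡ zeroV) → count (λ i → annihilates? f (basis (C i))) (allFin a) ≤ b) →
    a * (q ^ (n ∸ k) ∸ 1) ≤ (q ^ n ∸ 1) * b
  hyperplane-double-count {n} {k} {a} {b} k≤n C hyperplane≤b = begin
    a * D                                           ≡⟨ cong (_* D) (length-tabulate {n = a} (λ i → i)) ⟨
    length (allFin a) * D                           ≡⟨ ∑-const (allFin a) D ⟨
    ∑[ i ← allFin a ] D                             ≤⟨ ∑-mono (allFin a) (λ {i} _ → nonzero-annihilators k≤n (basis (C i))) ⟩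
    ∑[ i ← allFin a ] count (λ f → R? f i) V*       ≡⟨ double-counting R? V* (allFin a) ⟨
    ∑[ f ← V* ] count (R? f) (allFin a)             ≤⟨ ∑-mono V* (λ {f} f∈V* → hyperplane≤b f (nonzero f∈V*)) ⟩
    ∑[ f ← V* ] b                                   ≡⟨ ∑-const V* b ⟩
    length V* * b                                   ≡⟨ cong (_* b) (length-nonzeroVectors n) ⟩
    (q ^ n ∸ 1) * b                                 ∎
    where
    open ≤-Reasoning
    D : ℕ
    D = q ^ (n ∸ k) ∸ 1
    V* : List (Vector n)
    V* = nonzeroVectors n
    R? : (f : Vector n) (i : Fin a) → Dec (Annihilates f (basis (C i)))
    R? f i = annihilates? f (basis (C i))
    nonzero : ∀ {f} → f ∈ V* → ¬ (f ≡ zeroV)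
    nonzero f∈V* f≡0 = proj₂ (∈-filter⁻ (λ f → ¬? (zeroV ≟V f)) {xs = vectors n} f∈V*) (sym f≡0)

-- The operations on ℕ used in the statement are opened only here, since the
-- modules above use the same symbols for the field operations.
open import Data.Nat using (suc; _≤_; _<_; _*_; _∸_; _^_; _/_; z≤n; s≤s; >-nonZero)
open import Data.Nat.Properties
  using (≤-trans; <⇒≤; ∸-monoˡ-≤; *-identityʳ; ^-monoʳ-≤; m<n⇒0<n∸m; module ≤-Reasoning)
open import Data.Nat.DivMod using (m*n/n≡m; /-monoˡ-≤)
open import Data.Product using (_×_; _,_)
open import Relation.Binary.PropositionalEquality using (subst)

≤-⌊/⌋ : ∀ {a d N : ℕ} → 1 ≤ d → a * d ≤ N → a ≤ ⌊ N / d ⌋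
≤-⌊/⌋ {a} {suc d} {N} _ a*d≤N = subst (_≤ N / suc d) (m*n/n≡m a (suc d)) (/-monoˡ-≤ (suc d) a*d≤N)

1≤q^[n∸k]∸1 : ∀ {q} → 2 ≤ q → ∀ {n k} → k < n → 1 ≤ q ^ (n ∸ k) ∸ 1
1≤q^[n∸k]∸1 {q} 2≤q {n} {k} k<n = ∸-monoˡ-≤ 1 (begin
  2             ≤⟨ 2≤q ⟩
  q             ≡⟨ *-identityʳ q ⟨
  q ^ 1         ≤⟨ ^-monoʳ-≤ q {{>-nonZero (≤-trans (s≤s z≤n) 2≤q)}} (m<n⇒0<n∸m k<n) ⟩
  q ^ (n ∸ k)   ∎)
  where open ≤-Reasoning

proposition11 : (q : ℕ) → IsPrimePower q → (F : FiniteField q) →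
    (n k t λ′ : ℕ) → 1 ≤ t → t ≤ k → k < n → 1 ≤ λ′ →
    (a b c d : ℕ) →
    LinAlg.IsArq F n k t λ′ a → LinAlg.IsArq F (n ∸ 1) k t λ′ b →
    LinAlg.IsAq F n k t λ′ c → LinAlg.IsAq F (n ∸ 1) k t λ′ d →
    (a ≤ ⌊ (q ^ n ∸ 1) * b / (q ^ (n ∸ k) ∸ 1) ⌋)
    × (c ≤ ⌊ (q ^ n ∸ 1) * d / (q ^ (n ∸ k) ∸ 1) ⌋)
proposition11 q _ F (suc n) k _ _ _ _ k<n _ _ _ _ _
              ((A , packingA) , _) (_ , maximalB) ((C , packingC , noRepeatsC) , _) (_ , maximalD) =
  ≤-⌊/⌋ divisor-positive (hyperplane-double-count k≤n A (blocks-in-hyperplane≤ᵣ A packingA maximalB)) ,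
  ≤-⌊/⌋ divisor-positive (hyperplane-double-count k≤n C (blocks-in-hyperplane≤ C packingC noRepeatsC maximalD))
  where
  open Restriction F
  open DoubleCounting F
  k≤n : k ≤ suc n
  k≤n = <⇒≤ k<n
  divisor-positive : 1 ≤ q ^ (suc n ∸ k) ∸ 1
  divisor-positive = 1≤q^[n∸k]∸1 (Enumeration.two≤q F) k<n
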